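{- Let $a\ge 2$, $m\ge 2$, $b\ge 0$ be integers, let $s\ge H_m$, and let $n$ be a positive integer such that the tuple $$D_{\{a,b,s\}}(n)=(a^{b+1}n+1,\,a^{b+2}n+1,\,\dots,\,a^{b+s}n+1)$$ contains at least $m$ primes. Let $p_1<p_2<\dots<p_m$ be $m$ distinct primes among the entries of this tuple. Then $N=p_1p_2\cdots p_m$ is a radimichael number, i.e. $N$ is composite and $\operatorname{rad}(\varphi(N))\mid N-1$.
   Context: $\operatorname{rad}(m)$ denotes the largest squarefree divisor of $m$ and $\varphi$ is Euler's totient function. A radimichael number is a composite positive integer $n$ with $\operatorname{rad}(\varphi(n))\mid n-1$. $H_m$ denotes the constant provided by the Maynard–Tao theorem: a positive integer such that for all integers $a\ge2$, $b\ge0$ and $s\ge H_m$, at least $m$ entries of $D_{\{a,b,s\}}(n)$ are prime for infinitely many $n$. -}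

module Defs where

open import Data.Nat using (ℕ; zero; suc; _+_; _*_; _∸_; _^_; _≤_; _<_)
open import Data.Nat.Divisibility using (_∣_)
open import Data.Nat.Primality using (Prime; Composite)
open import Data.Nat.Coprimality using (Coprime; coprime?)
open import Data.List using (List; length; filter; upTo; map)
open import Data.Fin using (Fin; toℕ)
open import Data.Product using (Σ; ∃; _×_)
open import Function.Definitions using (Injective)
open import Relation.Binary.PropositionalEquality using (_≡_)
open import Relation.Nullary using (¬_)

φ : ℕ → ℕ
φ n = length (filter (λ k → coprime? k n) (map suc (upTo n)))

SquareFree : ℕ → Set
SquareFree d = ∀ p → Prime p → ¬ (p * p ∣ d)

IsRad : ℕ → ℕ → Set
IsRad m r = (r ∣ m) × SquareFree r × (∀ d → d ∣ m → SquareFree d → d ≤ r)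

Radimichael : ℕ → Set
Radimichael n = Composite n × (∀ r → IsRad (φ n) r → r ∣ n ∸ 1)

-- j-th entry (1 ≤ j ≤ s) of D_{a,b,s}(n) = a^(b+j) n + 1
entry : ℕ → ℕ → ℕ → ℕ → ℕ
entry a b n j = a ^ (b + j) * n + 1

AtLeastPrimes : ℕ → ℕ → ℕ → ℕ → ℕ → Set
AtLeastPrimes m a b s n =
  Σ (Fin m → Fin s) λ f → Injective _≡_ _≡_ f × (∀ i → Prime (entry a b n (suc (toℕ (f i)))))

MaynardTaoConstant : ℕ → ℕ → Set
MaynardTaoConstant m H =
  (0 < H) × (∀ a b s → 2 ≤ a → H ≤ s → ∀ K → ∃ λ n → K ≤ n × 0 < n × AtLeastPrimes m a b s n)

prod : (k : ℕ) → (Fin k → ℕ) → ℕ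
prod zero f = 1
prod (suc k) f = f Fin.zero * prod k (λ i → f (Fin.suc i))

module Submission where

-- Let p₁ < … < p_m be primes, each of the form a^e · n + 1 with e ≥ 1, and
-- put N = p₁ ⋯ p_m and d = a · n.  Every pᵢ is ≡ 1 (mod d), hence so is N,
-- i.e. d ∣ N - 1.  As the pᵢ are distinct primes, φ(N) = ∏ (pᵢ - 1), and
-- pᵢ - 1 = d · a^(e-1); so every prime dividing φ(N) divides d.  The radical
-- of φ(N) is squarefree, and a squarefree number all of whose prime factors
-- divide d divides d; thus rad(φ(N)) ∣ d ∣ N - 1.  N is composite as m ≥ 2.
-- The Maynard–Tao hypothesis only guarantees that such n exist; the
-- implication itself does not use it.

open import Defs
open import Data.Nat using (ℕ; suc; _+_; _*_; _^_; _≤_; _<_)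
open import Data.Nat.Primality using (Prime)
open import Data.Fin using (Fin; toℕ) renaming (_<_ to _<ᶠ_)
open import Data.Product using (∃; _×_)
open import Relation.Binary.PropositionalEquality using (_≡_)

open import Data.Bool using (Bool; true; false)
open import Data.Empty using (⊥-elim)
open import Data.Fin using () renaming (zero to fzero; suc to fsuc)
open import Data.List using (List; []; _∷_; length; filter; applyUpTo)
open import Data.List.Membership.Propositional using (_∈_)
open import Data.List.Properties using (map-upTo)
open import Data.List.Relation.Unary.All as All using (All; []; _∷_)
open import Data.Nat using (zero; _∸_; z<s; s<s; s≤s; NonZero; >-nonZero; nonTrivial⇒n>1; nonTrivial⇒≢1)
open import Data.Nat.Coprimality using (Coprime; coprime?; coprime-divisor; coprime-+)
  renaming (sym to coprime-sym)
open import Data.Nat.Divisibility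
  using (_∣_; divides; _∣?_; _∣0; ∣1⇒≡1; ∣-trans; m∣m*n; n∣m*n; ∣m⇒∣m*n;
         ∣m∣n⇒∣m+n; ∣m+n∣m⇒∣n; 1∣_; ∣⇒≤; *-monoʳ-∣; *-monoˡ-∣)
open import Data.Nat.ListAction using (product)
open import Data.Nat.ListAction.Properties using (∈⇒∣product)
open import Data.Nat.Primality
  using (Composite; composite; prime[2]; euclidsLemma; prime⇒irreducible; prime⇒nonTrivial)
open import Data.Nat.Primality.Factorisation using (factorise; PrimeFactorisation)
open import Data.Nat.Properties
  using (+-identityʳ; +-suc; +-comm; +-assoc; +-cancelʳ-≡; *-zeroʳ; *-suc; *-comm;
         <-irrefl; ≤-<-trans; <-≤-trans; *-mono-≤; m<m*n; m≤m*n)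
open import Data.Nat.Tactic.RingSolver using (solve-∀)
open import Data.Product using (_,_; proj₁; proj₂)
open import Data.Sum using (_⊎_; inj₁; inj₂; [_,_])
open import Function.Bundles using (_⇔_; mk⇔; Equivalence)
open import Relation.Binary.PropositionalEquality
  using (_≢_; refl; sym; trans; cong; cong₂; subst; module ≡-Reasoning)
open import Relation.Nullary using (¬_; Dec; yes; no; does; _×-dec_)
open import Relation.Unary using (Decidable)

open Equivalence using (to; from)

prime≢1 : ∀ {p} → Prime p → p ≢ 1
prime≢1 pp = nonTrivial⇒≢1 {{prime⇒nonTrivial pp}}

prime>1 : ∀ {p} → Prime p → 1 < p
prime>1 {p} pp = nonTrivial⇒n>1 p {{prime⇒nonTrivial pp}}

prime∤⇒coprime : ∀ {p k} → Prime p → ¬ p ∣ k → Coprime p k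
prime∤⇒coprime pp p∤k (d∣p , d∣k) with prime⇒irreducible pp d∣p
... | inj₁ d≡1 = d≡1
... | inj₂ refl = ⊥-elim (p∤k d∣k)

distinct-primes-coprime : ∀ {p q} → Prime p → Prime q → p ≢ q → Coprime p q
distinct-primes-coprime {p} {q} pp pq p≢q = prime∤⇒coprime pp p∤q
  where
  p∤q : ¬ p ∣ q
  p∤q p∣q with prime⇒irreducible pq p∣q
  ... | inj₁ p≡1 = prime≢1 pp p≡1
  ... | inj₂ p≡q = p≢q p≡q

coprime-∣ʳ : ∀ {m n d} → Coprime m n → d ∣ n → Coprime m d
coprime-∣ʳ m⊥n d∣n (e∣m , e∣d) = m⊥n (e∣m , ∣-trans e∣d d∣n)

coprime-∣ˡ : ∀ {m n d} → Coprime m n → d ∣ m → Coprime d n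
coprime-∣ˡ m⊥n d∣m (e∣d , e∣n) = m⊥n (∣-trans e∣d d∣m , e∣n)

coprime-*ʳ : ∀ {m x y} → Coprime m x → Coprime m y → Coprime m (x * y)
coprime-*ʳ m⊥x m⊥y (d∣m , d∣xy) =
  m⊥y (d∣m , coprime-divisor (coprime-∣ˡ m⊥x d∣m) d∣xy)

𝟙 : Bool → ℕ
𝟙 true = 1
𝟙 false = 0

-- count P? c L = #{ k : c < k ≤ c + L , P k }.
count : {P : ℕ → Set} → Decidable P → ℕ → ℕ → ℕ
count P? c zero = 0
count P? c (suc L) = 𝟙 (does (P? (suc c))) + count P? (suc c) L

length-filter-∷ : {P : ℕ → Set} (P? : Decidable P) (x : ℕ) (xs : List ℕ) →
  length (filter P? (x ∷ xs)) ≡ 𝟙 (does (P? x)) + length (filter P? xs)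
length-filter-∷ P? x xs with does (P? x)
... | true = refl
... | false = refl

count-filter : {P : ℕ → Set} (P? : Decidable P) (g : ℕ → ℕ) (c L : ℕ) →
  (∀ i → g i ≡ suc (c + i)) → length (filter P? (applyUpTo g L)) ≡ count P? c L
count-filter P? g c zero g≡ = refl
count-filter P? g c (suc L) g≡ = begin
  length (filter P? (g 0 ∷ applyUpTo (λ i → g (suc i)) L))
    ≡⟨ length-filter-∷ P? (g 0) _ ⟩
  𝟙 (does (P? (g 0))) + length (filter P? (applyUpTo (λ i → g (suc i)) L))
    ≡⟨ cong₂ _+_ (cong (λ k → 𝟙 (does (P? k))) g0≡) (count-filter P? _ (suc c) L gsuc≡) ⟩
  count P? c (suc L) ∎
  where
  open ≡-Reasoning
  g0≡ : g 0 ≡ suc c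
  g0≡ = trans (g≡ 0) (cong suc (+-identityʳ c))
  gsuc≡ : ∀ i → g (suc i) ≡ suc (suc c + i)
  gsuc≡ i = trans (g≡ (suc i)) (cong suc (+-suc c i))

φ-count : ∀ n → φ n ≡ count (λ k → coprime? k n) 0 n
φ-count n = trans (cong (λ xs → length (filter (λ k → coprime? k n) xs)) (map-upTo suc n))
                  (count-filter (λ k → coprime? k n) suc 0 n (λ _ → refl))

count-++ : {P : ℕ → Set} (P? : Decidable P) (c L M : ℕ) →
  count P? c (L + M) ≡ count P? c L + count P? (c + L) M
count-++ P? c zero M = cong (λ x → count P? x M) (sym (+-identityʳ c))
count-++ P? c (suc L) M = begin
  𝟙 (does (P? (suc c))) + count P? (suc c) (L + M)
    ≡⟨ cong (𝟙 (does (P? (suc c))) +_) (count-++ P? (suc c) L M) ⟩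
  𝟙 (does (P? (suc c))) + (count P? (suc c) L + count P? (suc c + L) M)
    ≡⟨ sym (+-assoc (𝟙 (does (P? (suc c)))) _ _) ⟩
  count P? c (suc L) + count P? (suc (c + L)) M
    ≡⟨ cong (λ x → count P? c (suc L) + count P? x M) (sym (+-suc c L)) ⟩
  count P? c (suc L) + count P? (c + suc L) M ∎
  where open ≡-Reasoning

count-cong : {P Q : ℕ → Set} (P? : Decidable P) (Q? : Decidable Q) →
  (∀ k → P k ⇔ Q k) → ∀ c L → count P? c L ≡ count Q? c L
count-cong P? Q? P⇔Q c zero = refl
count-cong P? Q? P⇔Q c (suc L) =
  cong₂ _+_ (𝟙-cong (P? (suc c)) (Q? (suc c)) (P⇔Q (suc c))) (count-cong P? Q? P⇔Q (suc c) L)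
  where
  𝟙-cong : ∀ {A B : Set} (a? : Dec A) (b? : Dec B) → A ⇔ B → 𝟙 (does a?) ≡ 𝟙 (does b?)
  𝟙-cong (yes _) (yes _) _ = refl
  𝟙-cong (yes a) (no ¬b) A⇔B = ⊥-elim (¬b (to A⇔B a))
  𝟙-cong (no ¬a) (yes b) A⇔B = ⊥-elim (¬a (from A⇔B b))
  𝟙-cong (no _) (no _) _ = refl

count-translate : {P : ℕ → Set} (P? : Decidable P) (M c L : ℕ) →
  count P? (c + M) L ≡ count (λ k → P? (k + M)) c L
count-translate P? M c zero = refl
count-translate P? M c (suc L) = cong (𝟙 (does (P? (suc c + M))) +_) (count-translate P? M (suc c) L)

count-periodic : {P : ℕ → Set} (P? : Decidable P) (M : ℕ) → (∀ k → P (k + M) ⇔ P k) →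
  ∀ q → count P? 0 (q * M) ≡ q * count P? 0 M
count-periodic P? M periodic zero = refl
count-periodic P? M periodic (suc q) = begin
  count P? 0 (M + q * M)                   ≡⟨ count-++ P? 0 M (q * M) ⟩
  count P? 0 M + count P? M (q * M)        ≡⟨ cong (count P? 0 M +_) shifted ⟩
  count P? 0 M + q * count P? 0 M ∎
  where
  open ≡-Reasoning
  shifted : count P? M (q * M) ≡ q * count P? 0 M
  shifted = trans (count-translate P? M 0 (q * M))
              (trans (count-cong _ P? periodic 0 (q * M)) (count-periodic P? M periodic q))

+-interchange : ∀ a b x y → (a + b) + (x + y) ≡ (a + x) + (b + y)
+-interchange = solve-∀

count-partition : {P Q R : ℕ → Set} (P? : Decidable P) (Q? : Decidable Q) (R? : Decidable R) →
  (∀ k → P k ⇔ (Q k ⊎ R k)) → (∀ k → Q k → ¬ R k) →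
  ∀ c L → count P? c L ≡ count Q? c L + count R? c L
count-partition P? Q? R? split disjoint c zero = refl
count-partition P? Q? R? split disjoint c (suc L) =
  trans (cong₂ _+_ (𝟙-split (P? (suc c)) (Q? (suc c)) (R? (suc c)) (split (suc c)) (disjoint (suc c)))
                   (count-partition P? Q? R? split disjoint (suc c) L))
        (+-interchange (𝟙 (does (Q? (suc c)))) (𝟙 (does (R? (suc c))))
                       (count Q? (suc c) L) (count R? (suc c) L))
  where
  𝟙-split : ∀ {A B C : Set} (a? : Dec A) (b? : Dec B) (c? : Dec C) →
    A ⇔ (B ⊎ C) → (B → ¬ C) → 𝟙 (does a?) ≡ 𝟙 (does b?) + 𝟙 (does c?)
  𝟙-split (yes _) (yes b) (yes c) _ B∩C = ⊥-elim (B∩C b c)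
  𝟙-split (yes _) (yes _) (no _) _ _ = refl
  𝟙-split (yes _) (no _) (yes _) _ _ = refl
  𝟙-split (yes a) (no ¬b) (no ¬c) A⇔B⊎C _ = ⊥-elim ([ ¬b , ¬c ] (to A⇔B⊎C a))
  𝟙-split (no ¬a) (yes b) _ A⇔B⊎C _ = ⊥-elim (¬a (from A⇔B⊎C (inj₁ b)))
  𝟙-split (no ¬a) (no _) (yes c) A⇔B⊎C _ = ⊥-elim (¬a (from A⇔B⊎C (inj₂ c)))
  𝟙-split (no _) (no _) (no _) _ _ = refl

count-none : {P : ℕ → Set} (P? : Decidable P) (c L : ℕ) →
  (∀ i → i < L → ¬ P (suc (c + i))) → count P? c L ≡ 0
count-none P? c zero none = refl
count-none {P} P? c (suc L) none with P? (suc c)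
... | yes Pc = ⊥-elim (none 0 z<s (subst (λ x → P (suc x)) (sym (+-identityʳ c)) Pc))
... | no _ = count-none P? (suc c) L
               (λ i i<L → subst (λ x → ¬ P (suc x)) (+-suc c i) (none (suc i) (s<s i<L)))

count-multiples : {P : ℕ → Set} (P? : Decidable P) (p : ℕ) .{{_ : NonZero p}} (c M : ℕ) →
  count (λ k → (p ∣? k) ×-dec P? k) (p * c) (p * M) ≡ count (λ j → P? (p * j)) c M
count-multiples P? p c zero = cong (count _ (p * c)) (*-zeroʳ p)
count-multiples {P} P? p@(suc p′) c (suc M) = begin
  count D? (p * c) (p * suc M)              ≡⟨ cong (count D? (p * c)) (*-suc p M) ⟩
  count D? (p * c) (p + p * M)              ≡⟨ count-++ D? (p * c) p (p * M) ⟩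
  count D? (p * c) p + count D? (p * c + p) (p * M)
    ≡⟨ cong₂ _+_ one-block (cong (λ x → count D? x (p * M)) next-block) ⟩
  𝟙 (does (P? (p * suc c))) + count D? (p * suc c) (p * M)
    ≡⟨ cong (𝟙 (does (P? (p * suc c))) +_) (count-multiples P? p (suc c) M) ⟩
  count (λ j → P? (p * j)) c (suc M) ∎
  where
  open ≡-Reasoning
  D? : Decidable (λ k → p ∣ k × P k)
  D? k = (p ∣? k) ×-dec P? k

  next-block : p * c + p ≡ p * suc c
  next-block = trans (+-comm (p * c) p) (sym (*-suc p c))

  no-multiple : ∀ i → i < p′ → ¬ (p ∣ suc (p * c + i) × P (suc (p * c + i)))
  no-multiple i i<p′ (p∣ , _) = <-irrefl refl (≤-<-trans (∣⇒≤ p∣suc-i) (s<s i<p′))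
    where
    p∣suc-i : p ∣ suc i
    p∣suc-i = ∣m+n∣m⇒∣n (subst (p ∣_) (sym (+-suc (p * c) i)) p∣) (m∣m*n c)

  𝟙-at-multiple : ∀ k → p ∣ k → 𝟙 (does (D? k)) ≡ 𝟙 (does (P? k))
  𝟙-at-multiple k p∣k = 𝟙-× (p ∣? k) (P? k) p∣k
    where
    𝟙-× : ∀ {A B : Set} (a? : Dec A) (b? : Dec B) → A → 𝟙 (does (a? ×-dec b?)) ≡ 𝟙 (does b?)
    𝟙-× (yes _) _ _ = refl
    𝟙-× (no ¬a) _ a = ⊥-elim (¬a a)

  -- Each block of length p contains exactly one multiple of p, its endpoint.
  one-block : count D? (p * c) p ≡ 𝟙 (does (P? (p * suc c)))
  one-block = begin
    count D? (p * c) p                    ≡⟨ cong (count D? (p * c)) (+-comm 1 p′) ⟩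
    count D? (p * c) (p′ + 1)             ≡⟨ count-++ D? (p * c) p′ 1 ⟩
    count D? (p * c) p′ + (𝟙 (does (D? (suc (p * c + p′)))) + 0)
      ≡⟨ cong₂ _+_ (count-none D? (p * c) p′ no-multiple) (+-identityʳ _) ⟩
    𝟙 (does (D? (suc (p * c + p′))))      ≡⟨ cong (λ k → 𝟙 (does (D? k))) endpoint ⟩
    𝟙 (does (D? (p * suc c)))             ≡⟨ 𝟙-at-multiple (p * suc c) (m∣m*n (suc c)) ⟩
    𝟙 (does (P? (p * suc c))) ∎
    where
    endpoint : suc (p * c + p′) ≡ p * suc c
    endpoint = trans (sym (+-suc (p * c) p′)) next-block

-- The k ∈ (0, p · M] coprime to M are p · φ(M) in number (periodicity); they
-- split into those coprime to p · M, counted by φ(p · M), and the multiples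
-- p · j of p with j coprime to M, of which there are φ(M).
φ-prime-* : ∀ {p M} → Prime p → Coprime p M → φ (p * M) ≡ (p ∸ 1) * φ M
φ-prime-* {suc p′} {M} pp p⊥M = +-cancelʳ-≡ (φ M) (φ (p * M)) (p′ * φ M) (begin
  φ (p * M) + φ M                  ≡⟨ cong₂ _+_ (φ-count (p * M)) (sym multiples) ⟩
  count B? 0 (p * M) + count C? 0 (p * M)
    ≡⟨ sym (count-partition A? B? C? split disjoint 0 (p * M)) ⟩
  count A? 0 (p * M)               ≡⟨ count-periodic A? M periodic p ⟩
  p * count A? 0 M                 ≡⟨ cong (p *_) (sym (φ-count M)) ⟩
  φ M + p′ * φ M                   ≡⟨ +-comm (φ M) (p′ * φ M) ⟩
  p′ * φ M + φ M ∎)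
  where
  open ≡-Reasoning
  p = suc p′
  A? : Decidable (λ k → Coprime k M)
  A? k = coprime? k M
  B? : Decidable (λ k → Coprime k (p * M))
  B? k = coprime? k (p * M)
  C? : Decidable (λ k → p ∣ k × Coprime k M)
  C? k = (p ∣? k) ×-dec coprime? k M

  split : ∀ k → Coprime k M ⇔ (Coprime k (p * M) ⊎ (p ∣ k × Coprime k M))
  split k = mk⇔ to-split [ from-coprime , proj₂ ]
    where
    from-coprime : Coprime k (p * M) → Coprime k M
    from-coprime k⊥pM = coprime-∣ʳ k⊥pM (n∣m*n p)
    to-split : Coprime k M → Coprime k (p * M) ⊎ (p ∣ k × Coprime k M)
    to-split k⊥M with p ∣? k
    ... | yes p∣k = inj₂ (p∣k , k⊥M)
    ... | no p∤k = inj₁ (coprime-*ʳ (coprime-sym (prime∤⇒coprime pp p∤k)) k⊥M)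

  disjoint : ∀ k → Coprime k (p * M) → ¬ (p ∣ k × Coprime k M)
  disjoint k k⊥pM (p∣k , _) = prime≢1 pp (k⊥pM (p∣k , m∣m*n M))

  periodic : ∀ k → Coprime (k + M) M ⇔ Coprime k M
  periodic k = mk⇔ unshift shift
    where
    unshift : Coprime (k + M) M → Coprime k M
    unshift k+M⊥M (d∣k , d∣M) = k+M⊥M (∣m∣n⇒∣m+n d∣k d∣M , d∣M)
    shift : Coprime k M → Coprime (k + M) M
    shift k⊥M = subst (λ x → Coprime x M) (+-comm M k) (coprime-+ k⊥M)

  dilation : ∀ j → Coprime (p * j) M ⇔ Coprime j M
  dilation j = mk⇔ undilate dilate
    where
    undilate : Coprime (p * j) M → Coprime j M
    undilate pj⊥M = coprime-∣ˡ pj⊥M (n∣m*n p)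
    dilate : Coprime j M → Coprime (p * j) M
    dilate j⊥M = coprime-sym (coprime-*ʳ (coprime-sym p⊥M) (coprime-sym j⊥M))

  multiples : count C? 0 (p * M) ≡ φ M
  multiples = begin
    count C? 0 (p * M)                   ≡⟨ cong (λ x → count C? x (p * M)) (sym (*-zeroʳ p)) ⟩
    count C? (p * 0) (p * M)             ≡⟨ count-multiples A? p 0 M ⟩
    count (λ j → A? (p * j)) 0 M         ≡⟨ count-cong _ A? dilation 0 M ⟩
    count A? 0 M                         ≡⟨ sym (φ-count M) ⟩
    φ M ∎

prod-pos : ∀ k (q : Fin k → ℕ) → (∀ i → 0 < q i) → 0 < prod k q
prod-pos zero q q>0 = z<s
prod-pos (suc k) q q>0 = *-mono-≤ (q>0 fzero) (prod-pos k (λ i → q (fsuc i)) (λ i → q>0 (fsuc i)))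

coprime-prod : ∀ {c} k (q : Fin k → ℕ) → (∀ i → Coprime c (q i)) → Coprime c (prod k q)
coprime-prod zero q c⊥q (_ , d∣1) = ∣1⇒≡1 d∣1
coprime-prod (suc k) q c⊥q = coprime-*ʳ (c⊥q fzero) (coprime-prod k (λ i → q (fsuc i)) (λ i → c⊥q (fsuc i)))

φ-prod : ∀ k (q : Fin k → ℕ) → (∀ i → Prime (q i)) → (∀ i j → i <ᶠ j → q i < q j) →
  φ (prod k q) ≡ prod k (λ i → q i ∸ 1)
φ-prod zero q prime increasing = refl
φ-prod (suc k) q prime increasing = begin
  φ (q fzero * prod k (λ i → q (fsuc i)))
    ≡⟨ φ-prime-* (prime fzero) (coprime-prod k _ first-coprime-rest) ⟩
  (q fzero ∸ 1) * φ (prod k (λ i → q (fsuc i)))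
    ≡⟨ cong ((q fzero ∸ 1) *_) (φ-prod k (λ i → q (fsuc i)) (λ i → prime (fsuc i))
                                  (λ i j i<j → increasing (fsuc i) (fsuc j) (s<s i<j))) ⟩
  prod (suc k) (λ i → q i ∸ 1) ∎
  where
  open ≡-Reasoning
  first-coprime-rest : ∀ i → Coprime (q fzero) (q (fsuc i))
  first-coprime-rest i = distinct-primes-coprime (prime fzero) (prime (fsuc i))
    (λ q₀≡qᵢ → <-irrefl q₀≡qᵢ (increasing fzero (fsuc i) z<s))

prime-∣-prod : ∀ {r} k (q : Fin k → ℕ) → Prime r → r ∣ prod k q → ∃ λ i → r ∣ q i
prime-∣-prod zero q pr r∣1 = ⊥-elim (prime≢1 pr (∣1⇒≡1 r∣1))
prime-∣-prod (suc k) q pr r∣prod with euclidsLemma (q fzero) (prod k (λ i → q (fsuc i))) pr r∣prod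
... | inj₁ r∣q₀ = fzero , r∣q₀
... | inj₂ r∣rest with prime-∣-prod k (λ i → q (fsuc i)) pr r∣rest
...   | i , r∣qᵢ = fsuc i , r∣qᵢ

prime-∣-^ : ∀ {r} a e → Prime r → r ∣ a ^ e → r ∣ a
prime-∣-^ a zero pr r∣1 = ⊥-elim (prime≢1 pr (∣1⇒≡1 r∣1))
prime-∣-^ a (suc e) pr r∣aᵉ⁺¹ with euclidsLemma a (a ^ e) pr r∣aᵉ⁺¹
... | inj₁ r∣a = r∣a
... | inj₂ r∣aᵉ = prime-∣-^ a e pr r∣aᵉ

one-mod-* : ∀ d t T → (1 + d * t) * (1 + d * T) ≡ 1 + d * (t + T + d * t * T)
one-mod-* = solve-∀

prod-one-mod : ∀ d k (q : Fin k → ℕ) → (∀ i → ∃ λ t → q i ≡ 1 + d * t) →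
  ∃ λ T → prod k q ≡ 1 + d * T
prod-one-mod d zero q q≡ = 0 , cong suc (sym (*-zeroʳ d))
prod-one-mod d (suc k) q q≡ with q≡ fzero | prod-one-mod d k (λ i → q (fsuc i)) (λ i → q≡ (fsuc i))
... | t , q₀≡ | T , rest≡ = t + T + d * t * T , trans (cong₂ _*_ q₀≡ rest≡) (one-mod-* d t T)

product-composite : ∀ {x y} → 1 < x → 1 < y → Composite (x * y)
product-composite {x@(suc (suc _))} {y} _ y>1 = composite (m<m*n x y y>1) (m∣m*n y)
product-composite {suc zero} (s≤s ()) _

prod-composite : ∀ k (q : Fin (suc (suc k)) → ℕ) → (∀ i → 1 < q i) → Composite (prod (suc (suc k)) q)
prod-composite k q q>1 = product-composite (q>1 fzero) rest>1
  where
  rest′ : ℕ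
  rest′ = prod k (λ i → q (fsuc (fsuc i)))
  rest′>0 : 0 < rest′
  rest′>0 = prod-pos k _ (λ i → <-≤-trans z<s (q>1 (fsuc (fsuc i))))
  rest>1 : 1 < q (fsuc fzero) * rest′
  rest>1 = <-≤-trans (q>1 (fsuc fzero)) (m≤m*n _ rest′ {{>-nonZero rest′>0}})

squarefree-∣ : ∀ {r d} → SquareFree r → d ∣ r → SquareFree d
squarefree-∣ sf d∣r q pq q²∣d = sf q pq (∣-trans q²∣d d∣r)

squarefree-product-∣ : ∀ {X} (qs : List ℕ) → All Prime qs → SquareFree (product qs) →
  All (_∣ X) qs → product qs ∣ X
squarefree-product-∣ {X} [] [] sf [] = 1∣ X
squarefree-product-∣ {X} (q ∷ qs) (pq ∷ pqs) sf (q∣X ∷ qs∣X)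
  with squarefree-product-∣ qs pqs (squarefree-∣ sf (n∣m*n q)) qs∣X
... | divides t X≡t*R = subst (q * R ∣_) (sym X≡t*R) (*-monoˡ-∣ R q∣t)
  where
  R : ℕ
  R = product qs
  -- q² ∤ q · R, so q ∤ R; as q ∣ X = t · R, q divides t.
  q∤R : ¬ q ∣ R
  q∤R q∣R = sf q pq (*-monoʳ-∣ q q∣R)
  q∣t : q ∣ t
  q∣t = coprime-divisor (prime∤⇒coprime pq q∤R) (subst (q ∣_) (trans X≡t*R (*-comm t R)) q∣X)

-- A squarefree number all of whose prime divisors divide X divides X.
-- (0 is not squarefree, as 2 · 2 ∣ 0.)
squarefree-∣-of-primes : ∀ {r X} → SquareFree r → (∀ q → Prime q → q ∣ r → q ∣ X) → r ∣ X
squarefree-∣-of-primes {zero} sf primes∣X = ⊥-elim (sf 2 prime[2] (4 ∣0))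
squarefree-∣-of-primes {r@(suc _)} {X} sf primes∣X =
  subst (_∣ X) (sym r≡∏) (squarefree-product-∣ factors factorsPrime (subst SquareFree r≡∏ sf)
                            (All.tabulate factor∣X))
  where
  open PrimeFactorisation (factorise r)
  r≡∏ : r ≡ product factors
  r≡∏ = isFactorisation
  factor∣X : ∀ {q} → q ∈ factors → q ∣ X
  factor∣X q∈ = primes∣X _ (All.lookup factorsPrime q∈) (subst (_ ∣_) (sym r≡∏) (∈⇒∣product q∈))

entry-form : ∀ a b n j → entry a b n (suc j) ≡ 1 + a * n * a ^ (b + j)
entry-form a b n j = begin
  a ^ (b + suc j) * n + 1     ≡⟨ cong (λ e → a ^ e * n + 1) (+-suc b j) ⟩
  a * a ^ (b + j) * n + 1     ≡⟨ rearrange a n (a ^ (b + j)) ⟩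
  1 + a * n * a ^ (b + j) ∎
  where
  open ≡-Reasoning
  rearrange : ∀ a n x → a * x * n + 1 ≡ 1 + a * n * x
  rearrange = solve-∀

lemma1 : (a m b s n H : ℕ) → 2 ≤ a → 2 ≤ m → MaynardTaoConstant m H → H ≤ s → 0 < n →
    (p : Fin m → ℕ) →
    (∀ i j → i <ᶠ j → p i < p j) →
    (∀ i → Prime (p i)) →
    (∀ i → ∃ λ j → 1 ≤ j × j ≤ s × p i ≡ entry a b n j) →
    Radimichael (prod m p)
lemma1 a m@(suc (suc k)) b s n H _ (s≤s (s≤s _)) _ _ _ p increasing prime entries =
  prod-composite k p (λ i → prime>1 (prime i)) , rad∣N-1
  where
  d : ℕ
  d = a * n
  p-form : ∀ i → ∃ λ e → p i ≡ 1 + d * a ^ e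
  p-form i with entries i
  ... | suc j , _ , _ , pᵢ≡ = b + j , trans pᵢ≡ (entry-form a b n j)
  -- Every prime factor of φ(N) = ∏ (pᵢ - 1) = ∏ d · a^e divides d.
  prime∣φN⇒∣d : ∀ q → Prime q → q ∣ φ (prod m p) → q ∣ d
  prime∣φN⇒∣d q pq q∣φN with prime-∣-prod m (λ i → p i ∸ 1) pq (subst (q ∣_) (φ-prod m p prime increasing) q∣φN)
  ... | i , q∣pᵢ-1 with p-form i
  ...   | e , pᵢ≡ with euclidsLemma d (a ^ e) pq (subst (λ x → q ∣ x ∸ 1) pᵢ≡ q∣pᵢ-1)
  ...     | inj₁ q∣d = q∣d
  ...     | inj₂ q∣aᵉ = ∣m⇒∣m*n n (prime-∣-^ a e pq q∣aᵉ)
  -- N = 1 + d · T, and rad(φ(N)) ∣ d.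
  rad∣N-1 : ∀ r → IsRad (φ (prod m p)) r → r ∣ prod m p ∸ 1
  rad∣N-1 r (r∣φN , r-squarefree , _) with prod-one-mod d m p (λ i → a ^ proj₁ (p-form i) , proj₂ (p-form i))
  ... | T , N≡ = subst (λ x → r ∣ x ∸ 1) (sym N≡)
                   (∣m⇒∣m*n T (squarefree-∣-of-primes r-squarefree
                                 (λ q pq q∣r → prime∣φN⇒∣d q pq (∣-trans q∣r r∣φN))))
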